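{- Let $\vec M\subseteq\mathbb N_\omega^d$. The membership problems in $\{(P,\vec y)\in 2^{\{1,\dots,d\}}\times\mathbb N_\omega^d\mid\vec y\in\downarrow_{\le_P}\vec M\}$ and in $\{(\vec f,\vec y)\in\mathbb N_\omega^d\times\mathbb N_\omega^d\mid\vec y\in\downarrow_{\vec f}\vec M\}$ are inter-reducible, effectively: from an algorithm solving either problem one can construct an algorithm solving the other.
   Context: $\mathbb N_\omega=\mathbb N\cup\{\omega\}$ with $n\le\omega$; $\le$ is componentwise on $\mathbb N_\omega^d$, $\downarrow$ the downward closure for $\le$. For $P\subseteq\{1,\dots,d\}$: $\vec x\le_P\vec y$ iff $\vec x(i)=\vec y(i)$ for $i\in P$ and $\vec x(i)\le\vec y(i)$ for $i\notin P$; $\downarrow_{\le_P}\vec M=\{\vec x\mid\exists\vec z\in\vec M,\ \vec x\le_P\vec z\}$. For $\vec f\in\mathbb N_\omega^d$: $\vec M|_{\vec f}=\{\vec x\in\vec M\mid\forall i,\ \vec f(i)<\omega\Rightarrow\vec x(i)=\vec f(i)\}$ and $\downarrow_{\vec f}\vec M=\downarrow(\vec M|_{\vec f})$. -}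

module Defs where

open import Data.Nat using (ℕ; _≤_)
open import Data.Fin using (Fin)
open import Data.Fin.Subset using (Subset; _∈_; _∉_)
open import Data.Product using (Σ; ∃; _×_)
open import Relation.Binary.PropositionalEquality using (_≡_)

data ℕω : Set where
  fin : ℕ → ℕω
  ω   : ℕω

data _≤ω_ : ℕω → ℕω → Set where
  fin≤fin : ∀ {m n} → m ≤ n → fin m ≤ω fin n
  ≤ω-top  : ∀ x → x ≤ω ω

_<ωtop : ℕω → Set
x <ωtop = ∃ λ n → x ≡ fin n

Vecω : ℕ → Set
Vecω d = Fin d → ℕω

_≤ᵥ_ : ∀ {d} → Vecω d → Vecω d → Set
x ≤ᵥ y = ∀ i → x i ≤ω y i

_≤[_]_ : ∀ {d} → Vecω d → Subset d → Vecω d → Set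
x ≤[ P ] y = ∀ i → (i ∈ P → x i ≡ y i) × (i ∉ P → x i ≤ω y i)

↓ : ∀ {d} → (Vecω d → Set) → Vecω d → Set
↓ M y = Σ (Vecω _) λ z → M z × y ≤ᵥ z

↓[_]_ : ∀ {d} → Subset d → (Vecω d → Set) → Vecω d → Set
(↓[ P ] M) y = Σ (Vecω _) λ z → M z × y ≤[ P ] z

_∣[_] : ∀ {d} → (Vecω d → Set) → Vecω d → Vecω d → Set
(M ∣[ f ]) x = M x × (∀ i → f i <ωtop → x i ≡ f i)

↓f[_]_ : ∀ {d} → Vecω d → (Vecω d → Set) → Vecω d → Set
↓f[ f ] M = ↓ (M ∣[ f ])

module Submission where

-- Both reductions are many-one reductions given by a
-- coordinatewise translation of the query, plus (in one direction) a
-- decidable side condition.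
--
--  * ↓_f M from ↓_P M.  Let P_f be the set of coordinates where f is finite
--    and y◃f the vector that agrees with f on P_f and with y elsewhere.  Then
--      y ∈ ↓_f M  ⇔  y ≤ y◃f  and  y◃f ∈ ↓_{≤_{P_f}} M,
--    and y ≤ y◃f is decidable since ≤ on ℕ_ω is.
--  * ↓_P M from ↓_f M.  Let f_{P,y} agree with y on P and be ω elsewhere.
--    Then y ∈ ↓_{≤_P} M  ⇔  y ∈ ↓_{f_{P,y}} M.
--
-- Each equivalence is proved one coordinate at a time, by a lemma about
-- single values of ℕ_ω in which "i ∈ P" is an arbitrary proposition Q; the
-- vector versions only regroup quantifiers.

open import Defs
open import Data.Nat using (ℕ; _≤?_)
open import Data.Nat.Properties using (≤-refl)
open import Data.Fin using (Fin)
open import Data.Fin.Properties using (all?)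
open import Data.Fin.Subset using (Subset; Side; inside; outside; _∈_)
open import Data.Fin.Subset.Properties using (_∈?_)
open import Data.Vec using (lookup; tabulate)
open import Data.Vec.Properties using ([]=⇒lookup; lookup⇒[]=; lookup∘tabulate)
open import Data.Product using (Σ; _×_; _,_; proj₁; proj₂)
open import Data.Empty using (⊥-elim)
open import Function.Bundles using (_⇔_; mk⇔; Equivalence)
open import Function.Properties.Equivalence using () renaming (sym to ⇔-sym; trans to ⇔-trans)
open import Relation.Nullary using (Dec; yes; no; ¬_; _×-dec_)
import Relation.Nullary.Decidable as Dec
open import Relation.Binary.PropositionalEquality using (_≡_; refl; sym; trans; subst; cong)

≤ω-refl : ∀ x → x ≤ω x
≤ω-refl (fin n) = fin≤fin ≤-refl
≤ω-refl ω       = ≤ω-top ω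

_≤ω?_ : ∀ x y → Dec (x ≤ω y)
x     ≤ω? ω     = yes (≤ω-top x)
ω     ≤ω? fin n = no λ ()
fin m ≤ω? fin n = Dec.map′ fin≤fin (λ { (fin≤fin m≤n) → m≤n }) (m ≤? n)

ω-maximal : ∀ {v} → ω ≤ω v → v ≡ ω
ω-maximal (≤ω-top ω) = refl

ω-infinite : ¬ (ω <ωtop)
ω-infinite (_ , ())

_≤ᵥ?_ : ∀ {d} (x y : Vecω d) → Dec (x ≤ᵥ y)
x ≤ᵥ? y = all? (λ i → x i ≤ω? y i)

-- Closure of M along a coordinatewise relation R: y ∈ ↓⟨ R ⟩ M iff some
-- z ∈ M has R i (y i) (z i) at every coordinate i.  Both closures of the
-- corollary are of this form (see ↓f-pointwise).
↓⟨_⟩ : ∀ {d} → (Fin d → ℕω → ℕω → Set) → (Vecω d → Set) → Vecω d → Set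
↓⟨ R ⟩ M y = Σ (Vecω _) λ z → M z × ∀ i → R i (y i) (z i)

↓⟨⟩-cong : ∀ {d} {R S : Fin d → ℕω → ℕω → Set} {M : Vecω d → Set} {y x : Vecω d} →
  (∀ i v → R i (y i) v ⇔ S i (x i) v) → ↓⟨ R ⟩ M y ⇔ ↓⟨ S ⟩ M x
↓⟨⟩-cong R⇔S = mk⇔
  (λ { (z , mz , r) → z , mz , λ i → Equivalence.to   (R⇔S i (z i)) (r i) })
  (λ { (z , mz , s) → z , mz , λ i → Equivalence.from (R⇔S i (z i)) (s i) })

↓⟨⟩-cong-side : ∀ {d} {R S : Fin d → ℕω → ℕω → Set} {C : Fin d → Set}
  {M : Vecω d → Set} {y x : Vecω d} →
  (∀ i v → R i (y i) v ⇔ (C i × S i (x i) v)) →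
  ↓⟨ R ⟩ M y ⇔ ((∀ i → C i) × ↓⟨ S ⟩ M x)
↓⟨⟩-cong-side R⇔CS = mk⇔
  (λ { (z , mz , r) →
         let cs = λ i → Equivalence.to (R⇔CS i (z i)) (r i)
         in (λ i → proj₁ (cs i)) , z , mz , λ i → proj₂ (cs i) })
  (λ { (c , z , mz , s) → z , mz , λ i → Equivalence.from (R⇔CS i (z i)) (c i , s i) })

-- The i-th coordinate condition of x ≤_P y, with "i ∈ P" abstracted to Q.
BelowAt : Set → ℕω → ℕω → Set
BelowAt Q u v = (Q → u ≡ v) × (¬ Q → u ≤ω v)

-- The i-th coordinate condition of y ∈ ↓_f {z}, for the value a = f i:
-- z i is pinned to a if a is finite, and lies above y i.
PinnedAt : ℕω → ℕω → ℕω → Set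
PinnedAt a u v = (a <ωtop → v ≡ a) × u ≤ω v

↓f-pointwise : ∀ {d} (f : Vecω d) (M : Vecω d → Set) (y : Vecω d) →
  (↓f[ f ] M) y ⇔ ↓⟨ (λ i → PinnedAt (f i)) ⟩ M y
↓f-pointwise f M y = mk⇔
  (λ { (z , (mz , pin) , le) → z , mz , λ i → pin i , le i })
  (λ { (z , mz , h) → z , (mz , λ i → proj₁ (h i)) , λ i → proj₂ (h i) })

override : ℕω → ℕω → ℕω
override (fin n) u = fin n
override ω       u = u

pinned⇔override : ∀ {Q : Set} a {u v} → (a <ωtop → Q) → (Q → a <ωtop) →
  PinnedAt a u v ⇔ (u ≤ω override a u × BelowAt Q (override a u) v)
pinned⇔override (fin n) {u} finite⇒Q Q⇒finite = mk⇔
  (λ { (pin , u≤v) → let v≡n = pin (n , refl) in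
         subst (u ≤ω_) v≡n u≤v , (λ _ → sym v≡n) , λ ¬Q → ⊥-elim (¬Q (finite⇒Q (n , refl))) })
  (λ { (u≤n , n≡v , _) → let v≡n = sym (n≡v (finite⇒Q (n , refl))) in
         (λ _ → v≡n) , subst (u ≤ω_) (sym v≡n) u≤n })
pinned⇔override ω {u} finite⇒Q Q⇒finite = mk⇔
  (λ { (_ , u≤v) → ≤ω-refl u , (λ q → ⊥-elim (ω-infinite (Q⇒finite q))) , λ _ → u≤v })
  (λ { (_ , _ , below) → (λ ω-fin → ⊥-elim (ω-infinite ω-fin)) , below (λ q → ω-infinite (Q⇒finite q)) })

sideOf : ℕω → Side
sideOf (fin _) = inside
sideOf ω       = outside

finiteCoords : ∀ {d} → Vecω d → Subset d
finiteCoords f = tabulate (λ i → sideOf (f i))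

finite⇒∈finiteCoords : ∀ {d} (f : Vecω d) i → f i <ωtop → i ∈ finiteCoords f
finite⇒∈finiteCoords f i (n , fi≡n) =
  lookup⇒[]= i (finiteCoords f) (trans (lookup∘tabulate _ i) (cong sideOf fi≡n))

∈finiteCoords⇒finite : ∀ {d} (f : Vecω d) i → i ∈ finiteCoords f → f i <ωtop
∈finiteCoords⇒finite f i i∈P = inside-finite (f i) (trans (sym ([]=⇒lookup i∈P)) (lookup∘tabulate _ i))
  where
  inside-finite : ∀ a → inside ≡ sideOf a → a <ωtop
  inside-finite (fin n) _ = n , refl

_◃_ : ∀ {d} → Vecω d → Vecω d → Vecω d
(y ◃ f) i = override (f i) (y i)

↓f-via-↓P : ∀ {d} (f : Vecω d) (M : Vecω d → Set) (y : Vecω d) →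
  (↓f[ f ] M) y ⇔ (y ≤ᵥ (y ◃ f) × (↓[ finiteCoords f ] M) (y ◃ f))
↓f-via-↓P f M y = ⇔-trans (↓f-pointwise f M y) (↓⟨⟩-cong-side
  {R = λ i → PinnedAt (f i)} {S = λ i → BelowAt (i ∈ finiteCoords f)} λ i v →
  pinned⇔override (f i) (finite⇒∈finiteCoords f i) (∈finiteCoords⇒finite f i))

pinned-self : ∀ {u v} → (u <ωtop → v ≡ u) → u ≤ω v → u ≡ v
pinned-self {fin n} pin _   = sym (pin (n , refl))
pinned-self {ω}     _   ω≤v = sym (ω-maximal ω≤v)

pinIf : ∀ {Q : Set} → Dec Q → ℕω → ℕω
pinIf (yes _) u = u
pinIf (no _)  _ = ω

below⇔pinIf : ∀ {Q : Set} (q? : Dec Q) {u v} → BelowAt Q u v ⇔ PinnedAt (pinIf q? u) u v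
below⇔pinIf (yes q) {u} = mk⇔
  (λ { (u≡v , _) → (λ _ → sym (u≡v q)) , subst (u ≤ω_) (u≡v q) (≤ω-refl u) })
  (λ { (pin , u≤v) → (λ _ → pinned-self pin u≤v) , λ ¬q → ⊥-elim (¬q q) })
below⇔pinIf (no ¬q) = mk⇔
  (λ { (_ , u≤v) → (λ ω-fin → ⊥-elim (ω-infinite ω-fin)) , u≤v ¬q })
  (λ { (_ , u≤v) → (λ q → ⊥-elim (¬q q)) , λ _ → u≤v })

pinOn : ∀ {d} → Subset d → Vecω d → Vecω d
pinOn P y i = pinIf (i ∈? P) (y i)

↓P-via-↓f : ∀ {d} (P : Subset d) (M : Vecω d → Set) (y : Vecω d) →
  (↓[ P ] M) y ⇔ (↓f[ pinOn P y ] M) y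
↓P-via-↓f P M y = ⇔-trans
  (↓⟨⟩-cong {R = λ i → BelowAt (i ∈ P)} {S = λ i → PinnedAt (pinOn P y i)} λ i v →
    below⇔pinIf (i ∈? P))
  (⇔-sym (↓f-pointwise (pinOn P y) M y))

decide-↓f : ∀ {d} (M : Vecω d → Set) →
  (∀ P y → Dec ((↓[ P ] M) y)) → ∀ f y → Dec ((↓f[ f ] M) y)
decide-↓f M decide-↓P f y =
  Dec.map (⇔-sym (↓f-via-↓P f M y)) (y ≤ᵥ? (y ◃ f) ×-dec decide-↓P (finiteCoords f) (y ◃ f))

decide-↓P : ∀ {d} (M : Vecω d → Set) →
  (∀ f y → Dec ((↓f[ f ] M) y)) → ∀ P y → Dec ((↓[ P ] M) y)
decide-↓P M decide-↓f P y = Dec.map (⇔-sym (↓P-via-↓f P M y)) (decide-↓f (pinOn P y) y)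

corollary5p5 : (d : ℕ) (M : Vecω d → Set) →
    ((∀ (P : Subset d) (y : Vecω d) → Dec ((↓[ P ] M) y)) →
      ∀ (f : Vecω d) (y : Vecω d) → Dec ((↓f[ f ] M) y))
    × ((∀ (f : Vecω d) (y : Vecω d) → Dec ((↓f[ f ] M) y)) →
      ∀ (P : Subset d) (y : Vecω d) → Dec ((↓[ P ] M) y))
corollary5p5 d M = decide-↓f M , decide-↓P M
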